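{- Let $n,m\ge1$ and $\ell:[m]\to[n]$ a map. The link of the origin (cone point) in $\Sigma_{n,m,\ell}$ has no 3-cycles: there do not exist three top-dimensional orthants $o_1,o_2,o_3\cong\mathbb{R}_{\ge0}^{n+m-2}$ of $\Sigma_{n,m,\ell}$ such that $o_1\cap o_2$, $o_2\cap o_3$, $o_3\cap o_1$ contain three pairwise distinct $(n+m-3)$-dimensional facets.
   Context: Notation: $[k]=\{1,\dots,k\}$. An ultrametric phylogenetic tree on a finite leaf set $L$ is a rooted tree with leaves bijectively labelled by $L$, no non-root degree-2 vertices, nonnegative edge lengths and all leaves equidistant from the root; leaves sit at time $0$ and each internal vertex has time equal to its distance to its descendant leaves; $d_T(i,j)$ is leaf-to-leaf path length. A nested tree of type $(n,m,\ell)$ is a pair $(T_H,T_P)$ of such trees on $[n]$ and $[m]$ with $d^P(i,j)\ge d^H(\ell(i),\ell(j))$ for all $i,j\in[m]$. It is fully resolved if both trees are binary and all $n+m-2$ internal vertices have pairwise distinct times $t^{(1)}<\dots<t^{(n+m-2)}$; the nesting sequence $S\in\{H,P\}^{n+m-2}$ records whether the $i$-th vertex lies in $T_H$ or $T_P$. The ranked topology of a binary tree with distinct internal times is its leaf-labelled shape with the time-order of internal vertices; the nested ranked topology is $(rt_H,rt_P,\ell,S)$; the $\sigma$-coordinates are $\sigma_i=t^{(i)}-t^{(i-1)}$, $t^{(0)}=0$. Each realisable nested ranked topology gives a top-dimensional orthant $\mathbb{R}_{\ge0}^{n+m-2}$ whose interior consists of the fully resolved nested trees of that topology and whose faces ($\sigma_i=0$)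 are the degenerate nested trees obtained by letting consecutive times coincide. $\Sigma_{n,m,\ell}$ is obtained by gluing these orthants along faces representing the same nested tree; all orthants share the origin (the height-$0$ star tree). The link of the origin is the simplicial complex obtained by intersecting $\Sigma_{n,m,\ell}$ with a small sphere around the origin. -}

module Defs where

open import Data.Nat using (ℕ; zero; suc; _≤_; _∸_; _+_; _<ᵇ_; pred)
open import Data.Fin using (Fin; toℕ; _≟_)
open import Data.Bool using (Bool; true; false; if_then_else_)
open import Data.List using (List; []; _∷_)
open import Data.Product using (_×_; _,_; proj₁; proj₂)
open import Data.Unit using (⊤)
open import Relation.Nullary using (¬_)
open import Relation.Nullary.Decidable using (⌊_⌋)
open import Relation.Binary.PropositionalEquality using (_≡_)

-- Ranked binary trees encoded as coalescent histories.
-- A block labelling of the leaf set [k] (here Fin k): two leaves are in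
-- the same current block (subtree) iff they have the same label.

Labels : ℕ → Set
Labels k = Fin k → Fin k

initLabels : ∀ {k} → Labels k
initLabels x = x

relabel : ∀ {k} → Labels k → Fin k → Fin k → Labels k
relabel L a b x = if ⌊ L x ≟ L b ⌋ then L a else L x

joined : ∀ {k} → Labels k → Fin k → Fin k → Bool
joined L a b = ⌊ L a ≟ L b ⌋

-- An internal vertex (coalescence event) of the host tree T_H (on [n])
-- or of the parasite tree T_P (on [m]); its constructor records the
-- nesting-sequence letter (H or P).
data Event (n m : ℕ) : Set where
  hmerge : Fin n → Fin n → Event n m
  pmerge : Fin m → Fin m → Event n m

State : ℕ → ℕ → Set
State n m = Labels n × Labels m

initState : ∀ {n m} → State n m
initState = initLabels , initLabels

step : ∀ {n m} → State n m → Event n m → State n m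
step (LH , LP) (hmerge a b) = relabel LH a b , LP
step (LH , LP) (pmerge i j) = LH , relabel LP i j

ValidStep : ∀ {n m} → State n m → Event n m → Set
ValidStep (LH , LP) (hmerge a b) = ¬ (LH a ≡ LH b)
ValidStep (LH , LP) (pmerge i j) = ¬ (LP i ≡ LP j)

AllValid : ∀ {n m} → State n m → List (Event n m) → Set
AllValid s [] = ⊤
AllValid s (e ∷ es) = ValidStep s e × AllValid (step s e) es

finalState : ∀ {n m} → State n m → List (Event n m) → State n m
finalState s [] = s
finalState s (e ∷ es) = finalState (step s e) es

-- rank (1-based position in the global time order, 0 if a = b) of the
-- most recent common ancestor of a, b in the host tree
rankH : ∀ {n m} → List (Event n m) → State n m → Fin n → Fin n → ℕ
rankH [] s a b = 0
rankH (e ∷ es) s a b =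
  if joined (proj₁ s) a b then 0 else suc (rankH es (step s e) a b)

rankP : ∀ {n m} → List (Event n m) → State n m → Fin m → Fin m → ℕ
rankP [] s i j = 0
rankP (e ∷ es) s i j =
  if joined (proj₂ s) i j then 0 else suc (rankP es (step s e) i j)

-- A realisable nested ranked topology of type (n, m, ℓ), i.e. a
-- top-dimensional orthant of Σ_{n,m,ℓ}, given by a history of
-- n + m - 2 binary coalescences (in time order t⁽¹⁾ < … < t⁽ⁿ⁺ᵐ⁻²⁾)
-- that ends with both trees fully joined and satisfies the nesting
-- condition d^P(i,j) ≥ d^H(ℓ i, ℓ j), i.e. rank of mrca_P(i,j) ≥
-- rank of mrca_H(ℓ i, ℓ j).

record Orthant (n m : ℕ) (ℓ : Fin m → Fin n) : Set where
  field
    history  : List (Event n m)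
    valid    : AllValid initState history
    completeH : ∀ a b → proj₁ (finalState initState history) a
                      ≡ proj₁ (finalState initState history) b
    completeP : ∀ i j → proj₂ (finalState initState history) i
                      ≡ proj₂ (finalState initState history) j
    nested   : ∀ i j → rankH history initState (ℓ i) (ℓ j)
                       ≤ rankP history initState i j

module _ {n m : ℕ} {ℓ : Fin m → Fin n} where
  open Orthant

  rH : Orthant n m ℓ → Fin n → Fin n → ℕ
  rH o = rankH (history o) initState

  rP : Orthant n m ℓ → Fin m → Fin m → ℕ
  rP o = rankP (history o) initState

  -- two orthants are the same iff they have the same nested ranked
  -- topology (ranked trees are determined by their mrca ranks)
  SameOrthant : Orthant n m ℓ → Orthant n m ℓ → Set
  SameOrthant o o' = (∀ a b → rH o a b ≡ rH o' a b)
                   × (∀ i j → rP o i j ≡ rP o' i j)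

  -- Facet σ_k = 0 (k = suc (toℕ k') ∈ {1,…,n+m-2}) of an orthant:
  -- t⁽ᵏ⁾ becomes equal to t⁽ᵏ⁻¹⁾, so the time index r of every vertex is
  -- collapsed to r if r < k and to r - 1 otherwise.
  collapse : ℕ → ℕ → ℕ
  collapse k r = if r <ᵇ k then r else pred r

  -- Facets of two orthants are glued (represent the same degenerate
  -- nested trees) iff their collapsed mrca-time data coincide, i.e.
  -- the leaf-to-leaf distances of both trees agree.
  SameFacet : Orthant n m ℓ → Fin (n + m ∸ 2)
            → Orthant n m ℓ → Fin (n + m ∸ 2) → Set
  SameFacet o k o' k' =
      (∀ a b → collapse (suc (toℕ k)) (rH o a b)
             ≡ collapse (suc (toℕ k')) (rH o' a b))
    × (∀ i j → collapse (suc (toℕ k)) (rP o i j)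
             ≡ collapse (suc (toℕ k')) (rP o' i j))

-- Each orthant is a coalescent history: a sequence of steps, each merging two blocks of the host
-- or of the parasite tree, and rH, rP give the (1-based) step at which two leaves become joined.
-- For a complete history rank a b ≤ t exactly when a and b are joined after t steps, so ranks
-- form an ultrametric in which any two pairs joined at the same step share a block.
-- The facet σ_{K+1} = 0 identifies the ranks K and K+1. If facet A of o were glued to facet B > A
-- of o', the two vertices of o' of ranks B and B+1 would both come from the single vertex of o of
-- rank B+1, which the ultrametric inequality rules out; hence glued facets have equal indices.
-- Around a triangle of gluings with indices K, J, I, the ranks u, v, x of a fixed pair of leaves
-- in the three orthants satisfy: u, v are equal or are {K, K+1}, likewise v, x with J and x, u
-- with I. Three such swaps cannot close up, so for J, I ≠ K this forces u = v for every pair,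
-- i.e. the first two orthants coincide.

module Submission where

open import Defs
open import Data.Nat using (ℕ; zero; suc; pred; _≤_; _<_; _+_; _∸_; _⊔_; _<ᵇ_; z≤n; s≤s)
open import Data.Nat.Properties
open import Data.Fin using (Fin; toℕ)
import Data.Fin as Fin
open import Data.Fin.Properties using (toℕ-injective; toℕ<n)
import Data.Fin.Properties as Finₚ
open import Data.Bool using (true; false; if_then_else_)
open import Data.Product using (_×_; _,_; proj₁; proj₂; ∃₂)
open import Data.List using (List; []; _∷_; length; map; take; catMaybes)
open import Data.Maybe using (Maybe; just; nothing)
open import Data.Sum using (_⊎_; inj₁; inj₂)
import Data.Sum as Sum
open import Data.Empty using (⊥; ⊥-elim)
open import Relation.Nullary using (¬_; yes; no; does)
open import Relation.Binary.Definitions using (tri<; tri≈; tri>)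
open import Relation.Nullary.Decidable using (⌊_⌋)
open import Relation.Unary using (Pred; Decidable; _⊆_)
open import Level using (0ℓ)
open import Relation.Binary.PropositionalEquality
open import Function using (_∘_)

-- Defs.collapse without the orthant parameters it does not depend on.
collapseℕ : ℕ → ℕ → ℕ
collapseℕ k r = if r <ᵇ k then r else pred r

collapse-≤ : ∀ {K t} → t ≤ K → collapseℕ (suc K) t ≡ t
collapse-≤ {K} {t} t≤K with t <ᵇ suc K | <⇒<ᵇ (s≤s t≤K)
... | true | _ = refl

collapse-> : ∀ {K t} → K < t → collapseℕ (suc K) t ≡ pred t
collapse-> {K} {t} K<t with t <ᵇ suc K | <ᵇ⇒< t (suc K)
... | true  | t≤K = ⊥-elim (<⇒≱ K<t (≤-pred (t≤K _)))
... | false | _   = refl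

collapse-above : ∀ {A B t} → A < B → collapseℕ (suc A) t ≡ B → t ≡ suc B
collapse-above {A} {B} {t} A<B eq with t ≤? A
... | yes t≤A = ⊥-elim (<⇒≱ A<B (subst (_≤ A) (trans (sym (collapse-≤ t≤A)) eq) t≤A))
... | no t≰A = pred-high (≰⇒> t≰A) (trans (sym (collapse-> (≰⇒> t≰A))) eq)
  where
  pred-high : ∀ {t} → A < t → pred t ≡ B → t ≡ suc B
  pred-high {suc t} _ = cong suc

collapse-below : ∀ {A B t} → A < B → t ≤ B → collapseℕ (suc A) t < B
collapse-below {A} {B} {t} A<B t≤B with t ≤? A
... | yes t≤A = subst (_< B) (sym (collapse-≤ t≤A)) (≤-<-trans t≤A A<B)
... | no t≰A = subst (_< B) (sym (collapse-> (≰⇒> t≰A))) (pred-< (≰⇒> t≰A) t≤B)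
  where
  pred-< : ∀ {t} → A < t → t ≤ B → pred t < B
  pred-< {suc t} _ t<B = t<B

collapse-<-reflects : ∀ {B t} → collapseℕ (suc B) t < B → t < B
collapse-<-reflects {B} {t} c<B with t ≤? B
... | yes t≤B = subst (_< B) (collapse-≤ t≤B) c<B
... | no t≰B = ⊥-elim (<⇒≱ c<B (pred-≥ (≰⇒> t≰B)))
  where
  pred-≥ : ∀ {t} → B < t → B ≤ collapseℕ (suc B) t
  pred-≥ {suc t} B<t = subst (B ≤_) (sym (collapse-> B<t)) (≤-pred B<t)

Straddles : ℕ → ℕ → ℕ → Set
Straddles K u v = (u ≡ K × v ≡ suc K) ⊎ (u ≡ suc K × v ≡ K)

straddles-sym : ∀ {K u v} → Straddles K u v → Straddles K v u
straddles-sym (inj₁ (p , q)) = inj₂ (q , p)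
straddles-sym (inj₂ (p , q)) = inj₁ (q , p)

straddles-unique : ∀ {K J u v} → Straddles K u v → Straddles J u v → K ≡ J
straddles-unique (inj₁ (refl , _)) (inj₁ (refl , _)) = refl
straddles-unique (inj₁ (refl , refl)) (inj₂ (() , refl))
straddles-unique (inj₂ (refl , refl)) (inj₁ (refl , ()))
straddles-unique (inj₂ (_ , refl)) (inj₂ (_ , refl)) = refl

-- Going round the triangle changes the rank by ±1 three times, which cannot add up to 0.
no-straddle-triangle : ∀ {K J I u v x} → Straddles K u v → Straddles J v x → Straddles I x u → ⊥
no-straddle-triangle (inj₁ (refl , refl)) (inj₁ (refl , refl)) (inj₁ (refl , ()))
no-straddle-triangle (inj₁ (refl , refl)) (inj₁ (refl , refl)) (inj₂ (refl , ()))
no-straddle-triangle (inj₁ (refl , refl)) (inj₂ (refl , refl)) (inj₁ (refl , ()))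
no-straddle-triangle (inj₁ (refl , refl)) (inj₂ (refl , refl)) (inj₂ (refl , ()))
no-straddle-triangle (inj₂ (refl , refl)) (inj₁ (refl , refl)) (inj₁ (refl , ()))
no-straddle-triangle (inj₂ (refl , refl)) (inj₁ (refl , refl)) (inj₂ (refl , ()))
no-straddle-triangle (inj₂ (refl , refl)) (inj₂ (refl , refl)) (inj₁ (refl , ()))
no-straddle-triangle (inj₂ (refl , refl)) (inj₂ (refl , refl)) (inj₂ (refl , ()))

straddles-pred : ∀ {K u v} → u ≤ K → K < v → u ≡ pred v → Straddles K u v
straddles-pred {v = suc v} v≤K (s≤s K≤v) refl = inj₁ (≤-antisym v≤K K≤v , cong suc (≤-antisym v≤K K≤v))

collapse-≡⇒straddles : ∀ {K u v} → collapseℕ (suc K) u ≡ collapseℕ (suc K) v → u ≢ v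
                      → Straddles K u v
collapse-≡⇒straddles {K} {u} {v} eq u≢v with u ≤? K | v ≤? K
... | yes u≤K | yes v≤K =
  ⊥-elim (u≢v (trans (sym (collapse-≤ u≤K)) (trans eq (collapse-≤ v≤K))))
... | yes u≤K | no v≰K =
  straddles-pred u≤K (≰⇒> v≰K) (trans (sym (collapse-≤ u≤K)) (trans eq (collapse-> (≰⇒> v≰K))))
... | no u≰K | yes v≤K =
  straddles-sym (straddles-pred v≤K (≰⇒> u≰K)
    (trans (sym (collapse-≤ v≤K)) (trans (sym eq) (collapse-> (≰⇒> u≰K)))))
... | no u≰K | no v≰K =
  ⊥-elim (u≢v (both-high (≰⇒> u≰K) (≰⇒> v≰K)
    (trans (sym (collapse-> (≰⇒> u≰K))) (trans eq (collapse-> (≰⇒> v≰K))))))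
  where
  both-high : ∀ {u v} → K < u → K < v → pred u ≡ pred v → u ≡ v
  both-high {suc u} {suc v} _ _ = cong suc

collapse-triangle : ∀ {K J I} u v x
  → collapseℕ (suc K) u ≡ collapseℕ (suc K) v
  → collapseℕ (suc J) v ≡ collapseℕ (suc J) x
  → collapseℕ (suc I) x ≡ collapseℕ (suc I) u
  → J ≢ K → I ≢ K → u ≡ v
collapse-triangle u v x eK eJ eI J≢K I≢K with u ≟ v
... | yes u≡v = u≡v
... | no u≢v with collapse-≡⇒straddles eK u≢v | v ≟ x | x ≟ u
...   | sK | yes refl | _ =
  ⊥-elim (I≢K (straddles-unique (collapse-≡⇒straddles eI (u≢v ∘ sym)) (straddles-sym sK)))
...   | sK | no v≢x | yes refl =
  ⊥-elim (J≢K (straddles-unique (collapse-≡⇒straddles eJ v≢x) (straddles-sym sK)))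
...   | sK | no v≢x | no x≢u =
  ⊥-elim (no-straddle-triangle sK (collapse-≡⇒straddles eJ v≢x) (collapse-≡⇒straddles eI x≢u))

count : ∀ {k} {P : Pred (Fin k) 0ℓ} → Decidable P → ℕ
count {zero}  P? = 0
count {suc k} P? = (if does (P? Fin.zero) then 1 else 0) + count (P? ∘ Fin.suc)

count-mono : ∀ {k} {P Q : Pred (Fin k) 0ℓ} (P? : Decidable P) (Q? : Decidable Q) → P ⊆ Q
           → count P? ≤ count Q?
count-mono {zero}  P? Q? P⊆Q = z≤n
count-mono {suc k} P? Q? P⊆Q with P? Fin.zero | Q? Fin.zero
... | yes p | yes _ = s≤s (count-mono (P? ∘ Fin.suc) (Q? ∘ Fin.suc) P⊆Q)
... | yes p | no ¬q = ⊥-elim (¬q (P⊆Q p))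
... | no _  | yes _ = m≤n⇒m≤1+n (count-mono (P? ∘ Fin.suc) (Q? ∘ Fin.suc) P⊆Q)
... | no _  | no _  = count-mono (P? ∘ Fin.suc) (Q? ∘ Fin.suc) P⊆Q

count-full : ∀ {k} {P : Pred (Fin k) 0ℓ} (P? : Decidable P) → (∀ x → P x) → count P? ≡ k
count-full {zero}  P? all = refl
count-full {suc k} P? all with P? Fin.zero
... | yes _ = cong suc (count-full (P? ∘ Fin.suc) (all ∘ Fin.suc))
... | no ¬p = ⊥-elim (¬p (all Fin.zero))

count-empty : ∀ {k} {P : Pred (Fin k) 0ℓ} (P? : Decidable P) → (∀ x → ¬ P x) → count P? ≡ 0
count-empty {zero}  P? none = refl
count-empty {suc k} P? none with P? Fin.zero
... | yes p = ⊥-elim (none Fin.zero p)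
... | no _  = count-empty (P? ∘ Fin.suc) (none ∘ Fin.suc)

count-≤1 : ∀ {k} {P : Pred (Fin k) 0ℓ} (P? : Decidable P) → (∀ {x y} → P x → P y → x ≡ y)
         → count P? ≤ 1
count-≤1 {zero}  P? unique = z≤n
count-≤1 {suc k} P? unique with P? Fin.zero
... | yes p = s≤s (≤-reflexive (count-empty (P? ∘ Fin.suc) (λ _ q → Finₚ.0≢1+n (unique p q))))
... | no _  = count-≤1 (P? ∘ Fin.suc) (λ p q → Finₚ.suc-injective (unique p q))

count-except : ∀ {k} {P Q : Pred (Fin k) 0ℓ} (P? : Decidable P) (Q? : Decidable Q) (x₀ : Fin k)
             → (∀ {x} → x ≢ x₀ → P x → Q x) → count P? ≤ suc (count Q?)
count-except {suc k} P? Q? Fin.zero P⊆Q with P? Fin.zero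
... | yes _ = s≤s (≤-trans (count-mono (P? ∘ Fin.suc) (Q? ∘ Fin.suc) (P⊆Q (λ ()))) (m≤n+m _ _))
... | no _  = m≤n⇒m≤1+n (≤-trans (count-mono (P? ∘ Fin.suc) (Q? ∘ Fin.suc) (P⊆Q (λ ()))) (m≤n+m _ _))
count-except {suc k} P? Q? (Fin.suc x₀) P⊆Q
  with count-except (P? ∘ Fin.suc) (Q? ∘ Fin.suc) x₀ (λ x≢x₀ → P⊆Q (x≢x₀ ∘ Finₚ.suc-injective))
     | P? Fin.zero | Q? Fin.zero
... | ih | yes _ | yes _  = s≤s ih
... | _  | yes p | no ¬q = ⊥-elim (¬q (P⊆Q (λ ()) p))
... | ih | no _  | yes _  = m≤n⇒m≤1+n ih
... | ih | no _  | no _   = ih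

module _ {k : ℕ} (L : Labels k) (a b : Fin k) where

  relabel-merged : ∀ {x} → L x ≡ L b → relabel L a b x ≡ L a
  relabel-merged {x} x∼b with L x Fin.≟ L b
  ... | yes _    = refl
  ... | no x≁b   = ⊥-elim (x≁b x∼b)

  relabel-other : ∀ {x} → L x ≢ L b → relabel L a b x ≡ L x
  relabel-other {x} x≁b with L x Fin.≟ L b
  ... | yes x∼b = ⊥-elim (x≁b x∼b)
  ... | no _    = refl

  relabel-joins : relabel L a b a ≡ relabel L a b b
  relabel-joins with L a Fin.≟ L b
  ... | yes _ = sym (relabel-merged refl)
  ... | no _  = sym (relabel-merged refl)

  relabel-preserves : ∀ {x y} → L x ≡ L y → relabel L a b x ≡ relabel L a b y
  relabel-preserves x∼y = cong (λ l → if ⌊ l Fin.≟ L b ⌋ then L a else l) x∼y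

  relabel-newly-joined : ∀ {x y} → L x ≢ L y → relabel L a b x ≡ relabel L a b y
                       → (L x ≡ L a × L y ≡ L b) ⊎ (L x ≡ L b × L y ≡ L a)
  relabel-newly-joined {x} {y} x≁y eq with L x Fin.≟ L b | L y Fin.≟ L b
  ... | yes x∼b | yes y∼b = ⊥-elim (x≁y (trans x∼b (sym y∼b)))
  ... | yes x∼b | no _    = inj₂ (x∼b , sym eq)
  ... | no _    | yes y∼b = inj₁ (eq , y∼b)
  ... | no _    | no _    = ⊥-elim (x≁y eq)

  relabel-newly-joined-share : ∀ {x y z w}
    → L x ≢ L y → relabel L a b x ≡ relabel L a b y
    → L z ≢ L w → relabel L a b z ≡ relabel L a b w
    → L x ≡ L z ⊎ L x ≡ L w
  relabel-newly-joined-share x≁y xy z≁w zw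
    with relabel-newly-joined x≁y xy | relabel-newly-joined z≁w zw
  ... | inj₁ (x∼a , _) | inj₁ (z∼a , _) = inj₁ (trans x∼a (sym z∼a))
  ... | inj₁ (x∼a , _) | inj₂ (_ , w∼a) = inj₂ (trans x∼a (sym w∼a))
  ... | inj₂ (x∼b , _) | inj₁ (_ , w∼b) = inj₂ (trans x∼b (sym w∼b))
  ... | inj₂ (x∼b , _) | inj₂ (z∼b , _) = inj₁ (trans x∼b (sym z∼b))

fixed? : ∀ {k} (L : Labels k) → Decidable (λ x → L x ≡ x)
fixed? L x = L x Fin.≟ x

-- The fixed points of a labelling are the representatives of its blocks; relabelling can only
-- remove the representative L b.
relabel-fixed : ∀ {k} (L : Labels k) a b → count (fixed? L) ≤ suc (count (fixed? (relabel L a b)))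
relabel-fixed L a b = count-except (fixed? L) (fixed? (relabel L a b)) (L b)
  λ x≢Lb Lx≡x → trans (relabel-other L a b (λ Lx∼Lb → x≢Lb (trans (sym Lx≡x) Lx∼Lb))) Lx≡x

-- One step of the history of a single tree: nothing when the step belongs to the other tree.
Merge : ℕ → Set
Merge k = Maybe (Fin k × Fin k)

apply : ∀ {k} → Labels k → Merge k → Labels k
apply L nothing        = L
apply L (just (a , b)) = relabel L a b

module _ {k : ℕ} where

  rank : List (Merge k) → Labels k → Fin k → Fin k → ℕ
  rank []       L a b = 0
  rank (μ ∷ μs) L a b = if joined L a b then 0 else suc (rank μs (apply L μ) a b)

  final : List (Merge k) → Labels k → Labels k
  final []       L = L
  final (μ ∷ μs) L = final μs (apply L μ)

  labelsAt : ℕ → List (Merge k) → Labels k → Labels k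
  labelsAt t μs = final (take t μs)

  JoinedAt : ℕ → List (Merge k) → Labels k → Fin k → Fin k → Set
  JoinedAt t μs L a b = labelsAt t μs L a ≡ labelsAt t μs L b

  JoinsAt : ℕ → List (Merge k) → Labels k → Fin k → Fin k → Set
  JoinsAt t μs L a b = ¬ JoinedAt t μs L a b × JoinedAt (suc t) μs L a b

  Complete : List (Merge k) → Labels k → Set
  Complete μs L = ∀ a b → final μs L a ≡ final μs L b

  apply-preserves : ∀ (L : Labels k) μ a b → L a ≡ L b → apply L μ a ≡ apply L μ b
  apply-preserves L nothing        a b a∼b = a∼b
  apply-preserves L (just (x , y)) a b = relabel-preserves L x y {a} {b}

  joined-persists : ∀ t μs L a b → L a ≡ L b → JoinedAt t μs L a b
  joined-persists zero    μs       L a b a∼b = a∼b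
  joined-persists (suc t) []       L a b a∼b = a∼b
  joined-persists (suc t) (μ ∷ μs) L a b a∼b =
    joined-persists t μs (apply L μ) a b (apply-preserves L μ a b a∼b)

  joinedAt⇒rank≤ : ∀ t μs L a b → JoinedAt t μs L a b → rank μs L a b ≤ t
  joinedAt⇒rank≤ t [] L a b _ = z≤n
  joinedAt⇒rank≤ t (μ ∷ μs) L a b j with L a Fin.≟ L b
  ... | yes _ = z≤n
  joinedAt⇒rank≤ zero    (μ ∷ μs) L a b j | no a≁b = ⊥-elim (a≁b j)
  joinedAt⇒rank≤ (suc t) (μ ∷ μs) L a b j | no _   = s≤s (joinedAt⇒rank≤ t μs (apply L μ) a b j)

  -- rank is 0 on a pair that is never joined, hence the completeness hypothesis.
  rank≤⇒joinedAt : ∀ t μs L a b → Complete μs L → rank μs L a b ≤ t → JoinedAt t μs L a b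
  rank≤⇒joinedAt zero    [] L a b complete _ = complete a b
  rank≤⇒joinedAt (suc t) [] L a b complete _ = complete a b
  rank≤⇒joinedAt t (μ ∷ μs) L a b complete r≤t with L a Fin.≟ L b
  ... | yes a∼b = joined-persists t (μ ∷ μs) L a b a∼b
  rank≤⇒joinedAt (suc t) (μ ∷ μs) L a b complete (s≤s r≤t) | no _ =
    rank≤⇒joinedAt t μs (apply L μ) a b complete r≤t

  rank≡suc⇒joinsAt : ∀ μs L a b {v} → Complete μs L → rank μs L a b ≡ suc v → JoinsAt v μs L a b
  rank≡suc⇒joinsAt μs L a b {v} complete r≡1+v =
      (λ j → 1+n≰n (subst (_≤ v) r≡1+v (joinedAt⇒rank≤ v μs L a b j)))
    , rank≤⇒joinedAt (suc v) μs L a b complete (≤-reflexive r≡1+v)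

  joinsAt⇒rank≡suc : ∀ μs L a b {v} → Complete μs L → JoinsAt v μs L a b → rank μs L a b ≡ suc v
  joinsAt⇒rank≡suc μs L a b {v} complete (¬j , j) =
    ≤-antisym (joinedAt⇒rank≤ (suc v) μs L a b j) (≰⇒> (¬j ∘ rank≤⇒joinedAt v μs L a b complete))

  ¬joinsAt-[] : ∀ v {L a b} → ¬ JoinsAt v [] L a b
  ¬joinsAt-[] zero    (¬j , j) = ¬j j
  ¬joinsAt-[] (suc v) (¬j , j) = ¬j j

  ¬joinsAt-idle : ∀ μs {L a b} → ¬ JoinsAt zero (nothing ∷ μs) L a b
  ¬joinsAt-idle μs (¬j , j) = ¬j j

  joinsAt-share : ∀ v μs L x y z w → JoinsAt v μs L x y → JoinsAt v μs L z w
                → JoinedAt v μs L x z ⊎ JoinedAt v μs L x w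
  joinsAt-share v       []                  L x y z w xy _ = ⊥-elim (¬joinsAt-[] v xy)
  joinsAt-share zero    (nothing ∷ μs)      L x y z w xy _ = ⊥-elim (¬joinsAt-idle μs {L} xy)
  joinsAt-share zero    (just (a , b) ∷ μs) L x y z w (x≁y , x∼y) (z≁w , z∼w) =
    relabel-newly-joined-share L a b x≁y x∼y z≁w z∼w
  joinsAt-share (suc v) (μ ∷ μs)            L = joinsAt-share v μs (apply L μ)

record IsCoalescentRanking {X : Set} (r : X → X → ℕ) : Set where
  field
    symmetric    : ∀ a b → r a b ≡ r b a
    ultrametric  : ∀ a b c → r a c ≤ r a b ⊔ r b c
    shared-merge : ∀ {x y z w v} → r x y ≡ suc v → r z w ≡ suc v → r x z ≤ v ⊎ r x w ≤ v

  isosceles : ∀ {a b c} → r a b < r b c → r a c ≡ r b c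
  isosceles {a} {b} {c} ab<bc =
    ≤-antisym (≤-trans (ultrametric a b c) (≤-reflexive (m≤n⇒m⊔n≡n (<⇒≤ ab<bc)))) bc≤ac
    where
    bc≤ac : r b c ≤ r a c
    bc≤ac with ⊔-sel (r b a) (r a c)
    ... | inj₁ ⊔≡ba = ⊥-elim (<⇒≱ ab<bc (subst (r b c ≤_) (trans ⊔≡ba (symmetric b a)) (ultrametric b a c)))
    ... | inj₂ ⊔≡ac = subst (r b c ≤_) ⊔≡ac (ultrametric b a c)

IsCoalescentRanking-resp : ∀ {X} {r r' : X → X → ℕ} → (∀ a b → r a b ≡ r' a b)
                         → IsCoalescentRanking r → IsCoalescentRanking r'
IsCoalescentRanking-resp {r = r} {r'} r≡r' R = record
  { symmetric    = λ a b → trans (sym (r≡r' a b)) (trans (symmetric a b) (r≡r' b a))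
  ; ultrametric  = ultrametric'
  ; shared-merge = λ {x} {y} {z} {w} {v} xy zw →
      Sum.map (subst (_≤ v) (r≡r' x z)) (subst (_≤ v) (r≡r' x w))
              (shared-merge (trans (r≡r' x y) xy) (trans (r≡r' z w) zw))
  }
  where
  open IsCoalescentRanking R
  ultrametric' : ∀ a b c → r' a c ≤ r' a b ⊔ r' b c
  ultrametric' a b c rewrite sym (r≡r' a c) | sym (r≡r' a b) | sym (r≡r' b c) = ultrametric a b c

rank-isCoalescentRanking : ∀ {k} (μs : List (Merge k)) L → Complete μs L
                         → IsCoalescentRanking (rank μs L)
rank-isCoalescentRanking μs L complete = record
  { symmetric    = λ a b → ≤-antisym (≤-rank-of a b) (≤-rank-of b a)
  ; ultrametric  = λ a b c →
      let t = rank μs L a b ⊔ rank μs L b c in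
      joinedAt⇒rank≤ t μs L a c (trans (rank≤⇒joinedAt t μs L a b complete (m≤m⊔n _ _))
                                       (rank≤⇒joinedAt t μs L b c complete (m≤n⊔m _ _)))
  ; shared-merge = λ {x} {y} {z} {w} {v} xy zw →
      Sum.map (joinedAt⇒rank≤ v μs L x z) (joinedAt⇒rank≤ v μs L x w)
              (joinsAt-share v μs L x y z w (rank≡suc⇒joinsAt μs L x y complete xy)
                                            (rank≡suc⇒joinsAt μs L z w complete zw))
  }
  where
  ≤-rank-of : ∀ a b → rank μs L a b ≤ rank μs L b a
  ≤-rank-of a b = joinedAt⇒rank≤ _ μs L a b (sym (rank≤⇒joinedAt _ μs L b a complete ≤-refl))

mergeCount : ∀ {k} → List (Merge k) → ℕ
mergeCount μs = length (catMaybes μs)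

fixed-final : ∀ {k} (μs : List (Merge k)) L
            → count (fixed? L) ≤ count (fixed? (final μs L)) + mergeCount μs
fixed-final []                  L = ≤-reflexive (sym (+-identityʳ _))
fixed-final (nothing ∷ μs)      L = fixed-final μs L
fixed-final (just (a , b) ∷ μs) L = begin
  count (fixed? L)                                    ≤⟨ relabel-fixed L a b ⟩
  suc (count (fixed? (relabel L a b)))                ≤⟨ s≤s (fixed-final μs (relabel L a b)) ⟩
  suc (count (fixed? (final μs (relabel L a b))) + mergeCount μs) ≡⟨ +-suc _ _ ⟨
  count (fixed? (final μs (relabel L a b))) + suc (mergeCount μs) ∎
  where open ≤-Reasoning

complete⇒enough-merges : ∀ {k} (μs : List (Merge k)) → Complete μs initLabels → k ≤ suc (mergeCount μs)
complete⇒enough-merges {k} μs complete = begin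
  k                                                  ≡⟨ count-full (fixed? (initLabels {k})) (λ _ → refl) ⟨
  count (fixed? (initLabels {k}))                    ≤⟨ fixed-final μs initLabels ⟩
  count (fixed? (final μs initLabels)) + mergeCount μs ≤⟨ +-monoˡ-≤ (mergeCount μs) final-fixed≤1 ⟩
  suc (mergeCount μs)                                ∎
  where
  open ≤-Reasoning
  final-fixed≤1 : count (fixed? (final μs initLabels)) ≤ 1
  final-fixed≤1 = count-≤1 (fixed? (final μs initLabels))
    λ {x} {y} Fx≡x Fy≡y → trans (sym Fx≡x) (trans (complete x y) Fy≡y)

module _ {n m : ℕ} where

  hostMerge : Event n m → Merge n
  hostMerge (hmerge a b) = just (a , b)
  hostMerge (pmerge _ _) = nothing

  parasiteMerge : Event n m → Merge m
  parasiteMerge (hmerge _ _) = nothing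
  parasiteMerge (pmerge i j) = just (i , j)

  hostMerges : List (Event n m) → List (Merge n)
  hostMerges = map hostMerge

  parasiteMerges : List (Event n m) → List (Merge m)
  parasiteMerges = map parasiteMerge

  host-step : ∀ s e → proj₁ (step s e) ≡ apply (proj₁ s) (hostMerge e)
  host-step s (hmerge a b) = refl
  host-step s (pmerge i j) = refl

  parasite-step : ∀ s e → proj₂ (step s e) ≡ apply (proj₂ s) (parasiteMerge e)
  parasite-step s (hmerge a b) = refl
  parasite-step s (pmerge i j) = refl

  rankH≡rank : ∀ es s a b → rankH es s a b ≡ rank (hostMerges es) (proj₁ s) a b
  rankH≡rank []       s a b = refl
  rankH≡rank (e ∷ es) s a b = cong (λ r → if joined (proj₁ s) a b then 0 else suc r)
    (trans (rankH≡rank es (step s e) a b) (cong (λ L → rank (hostMerges es) L a b) (host-step s e)))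

  rankP≡rank : ∀ es s i j → rankP es s i j ≡ rank (parasiteMerges es) (proj₂ s) i j
  rankP≡rank []       s i j = refl
  rankP≡rank (e ∷ es) s i j = cong (λ r → if joined (proj₂ s) i j then 0 else suc r)
    (trans (rankP≡rank es (step s e) i j)
           (cong (λ L → rank (parasiteMerges es) L i j) (parasite-step s e)))

  finalState-host : ∀ es s → proj₁ (finalState s es) ≡ final (hostMerges es) (proj₁ s)
  finalState-host []       s = refl
  finalState-host (e ∷ es) s =
    trans (finalState-host es (step s e)) (cong (final (hostMerges es)) (host-step s e))

  finalState-parasite : ∀ es s → proj₂ (finalState s es) ≡ final (parasiteMerges es) (proj₂ s)
  finalState-parasite []       s = refl
  finalState-parasite (e ∷ es) s =
    trans (finalState-parasite es (step s e)) (cong (final (parasiteMerges es)) (parasite-step s e))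

  length≡mergeCounts : ∀ es → length es ≡ mergeCount (hostMerges es) + mergeCount (parasiteMerges es)
  length≡mergeCounts []               = refl
  length≡mergeCounts (hmerge _ _ ∷ es) = cong suc (length≡mergeCounts es)
  length≡mergeCounts (pmerge _ _ ∷ es) = trans (cong suc (length≡mergeCounts es)) (sym (+-suc _ _))

  some-tree-joins : ∀ es s → AllValid s es → ∀ {v} → v < length es
    → (∃₂ λ a b → JoinsAt v (hostMerges es) (proj₁ s) a b)
    ⊎ (∃₂ λ i j → JoinsAt v (parasiteMerges es) (proj₂ s) i j)
  some-tree-joins (hmerge a b ∷ es) s (a≁b , _) {zero} _ = inj₁ (a , b , a≁b , relabel-joins (proj₁ s) a b)
  some-tree-joins (pmerge i j ∷ es) s (i≁j , _) {zero} _ = inj₂ (i , j , i≁j , relabel-joins (proj₂ s) i j)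
  some-tree-joins (e@(hmerge _ _) ∷ es) s (_ , valid) {suc v} (s≤s v<) = some-tree-joins es (step s e) valid v<
  some-tree-joins (e@(pmerge _ _) ∷ es) s (_ , valid) {suc v} (s≤s v<) = some-tree-joins es (step s e) valid v<

  trees-join-at-distinct-times : ∀ es s v {a b i j} → JoinsAt v (hostMerges es) (proj₁ s) a b
                               → ¬ JoinsAt v (parasiteMerges es) (proj₂ s) i j
  trees-join-at-distinct-times [] s v ab _ = ¬joinsAt-[] v ab
  trees-join-at-distinct-times (hmerge _ _ ∷ es) s zero _ ij = ¬joinsAt-idle (parasiteMerges es) {proj₂ s} ij
  trees-join-at-distinct-times (pmerge _ _ ∷ es) s zero ab _ = ¬joinsAt-idle (hostMerges es) {proj₁ s} ab
  trees-join-at-distinct-times (e@(hmerge _ _) ∷ es) s (suc v) ab ij =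
    trees-join-at-distinct-times es (step s e) v ab ij
  trees-join-at-distinct-times (e@(pmerge _ _) ∷ es) s (suc v) ab ij =
    trees-join-at-distinct-times es (step s e) v ab ij

-- r, r' rank one tree in orthants o, o' whose facets A+1 and B+1 are glued. Collapsing at B+1
-- folds the ranks B and B+1 of r' onto B, while only the rank B+1 of r lands on B: so pairs of
-- r'-ranks B and B+1 are joined by one merge of o, and the isosceles property of r' then
-- produces a pair contradicting the shared merge of o.
module GluedRankings {X : Set} {r r' : X → X → ℕ}
                     (R : IsCoalescentRanking r) (R' : IsCoalescentRanking r')
                     {A B : ℕ} (A<B : A < B)
                     (glued : ∀ p q → collapseℕ (suc A) (r p q) ≡ collapseℕ (suc B) (r' p q)) where
  open IsCoalescentRanking R using (shared-merge)
  open IsCoalescentRanking R' using () renaming (symmetric to symmetric'; isosceles to isosceles')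

  lift-B : ∀ {p q} → r' p q ≡ B → r p q ≡ suc B
  lift-B {p} {q} eq = collapse-above A<B
    (trans (glued p q) (trans (cong (collapseℕ (suc B)) eq) (collapse-≤ ≤-refl)))

  lift-suc-B : ∀ {p q} → r' p q ≡ suc B → r p q ≡ suc B
  lift-suc-B {p} {q} eq = collapse-above A<B
    (trans (glued p q) (trans (cong (collapseℕ (suc B)) eq) (collapse-> ≤-refl)))

  lower-below : ∀ {p q} → r p q ≤ B → r' p q < B
  lower-below {p} {q} r≤B = collapse-<-reflects (subst (_< B) (glued p q) (collapse-below A<B r≤B))

  private
    ≢suc-B : ∀ {t} → t ≡ suc B → ¬ t ≤ B
    ≢suc-B refl = 1+n≰n

    across : ∀ {y₁ y₂ w w'} → r' y₁ y₂ ≡ B → r' w w' ≡ suc B → ¬ r y₁ w ≤ B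
    across {y₁} {y₂} {w} {w'} y₁y₂≡B ww'≡1+B y₁w≤B =
      Sum.[ ≢suc-B (lift-suc-B y₁w'≡1+B) , ≢suc-B (lift-B y₁y₂≡B) ]
        (shared-merge (lift-B y₁y₂≡B) (lift-suc-B (trans (symmetric' w' y₂) y₂w'≡1+B)))
      where
      y₁w<B : r' y₁ w < B
      y₁w<B = lower-below y₁w≤B
      B<ww' : B < r' w w'
      B<ww' = subst (B <_) (sym ww'≡1+B) (n<1+n B)
      y₁w'≡1+B : r' y₁ w' ≡ suc B
      y₁w'≡1+B = trans (isosceles' (<-trans y₁w<B B<ww')) ww'≡1+B
      wy₂≡B : r' w y₂ ≡ B
      wy₂≡B = trans (isosceles' (subst₂ _<_ (symmetric' y₁ w) (sym y₁y₂≡B) y₁w<B)) y₁y₂≡B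
      y₂w'≡1+B : r' y₂ w' ≡ suc B
      y₂w'≡1+B = trans (isosceles' (subst (_< r' w w') (trans (sym wy₂≡B) (symmetric' w y₂)) B<ww')) ww'≡1+B

  ¬successive : ∀ {y₁ y₂ z₁ z₂} → r' y₁ y₂ ≡ B → r' z₁ z₂ ≡ suc B → ⊥
  ¬successive {y₁} {y₂} {z₁} {z₂} y≡B z≡1+B =
    Sum.[ across y≡B z≡1+B , across y≡B (trans (symmetric' z₂ z₁) z≡1+B) ]
      (shared-merge (lift-B y≡B) (lift-suc-B z≡1+B))

module _ {n m : ℕ} {ℓ : Fin m → Fin n} (o : Orthant n m ℓ) where
  open Orthant o

  private
    hs : List (Merge n)
    hs = hostMerges history

    ps : List (Merge m)
    ps = parasiteMerges history

    rH≡rank : ∀ a b → rH o a b ≡ rank hs initLabels a b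
    rH≡rank = rankH≡rank history initState

    rP≡rank : ∀ i j → rP o i j ≡ rank ps initLabels i j
    rP≡rank = rankP≡rank history initState

  host-complete : Complete hs initLabels
  host-complete a b = subst (λ L → L a ≡ L b) (finalState-host history initState) (completeH a b)

  parasite-complete : Complete ps initLabels
  parasite-complete i j = subst (λ L → L i ≡ L j) (finalState-parasite history initState) (completeP i j)

  host-ranking : IsCoalescentRanking (rH o)
  host-ranking = IsCoalescentRanking-resp (λ a b → sym (rH≡rank a b))
                                          (rank-isCoalescentRanking hs initLabels host-complete)

  parasite-ranking : IsCoalescentRanking (rP o)
  parasite-ranking = IsCoalescentRanking-resp (λ i j → sym (rP≡rank i j))
                                              (rank-isCoalescentRanking ps initLabels parasite-complete)

  length-history : n + m ∸ 2 ≤ length history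
  length-history = begin
    n + m ∸ 2                         ≤⟨ ∸-monoˡ-≤ 2 (+-mono-≤ (complete⇒enough-merges hs host-complete)
                                                               (complete⇒enough-merges ps parasite-complete)) ⟩
    suc (mergeCount hs) + suc (mergeCount ps) ∸ 2 ≡⟨ cong (_∸ 1) (+-suc (mergeCount hs) (mergeCount ps)) ⟩
    mergeCount hs + mergeCount ps     ≡⟨ length≡mergeCounts history ⟨
    length history                    ∎
    where open ≤-Reasoning

  VertexAt : ℕ → Set
  VertexAt v = (∃₂ λ a b → rH o a b ≡ suc v) ⊎ (∃₂ λ i j → rP o i j ≡ suc v)

  vertexAt : ∀ {v} → v < n + m ∸ 2 → VertexAt v
  vertexAt v<N = Sum.map
    (λ (a , b , ab) → a , b , trans (rH≡rank a b) (joinsAt⇒rank≡suc hs initLabels a b host-complete ab))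
    (λ (i , j , ij) → i , j , trans (rP≡rank i j) (joinsAt⇒rank≡suc ps initLabels i j parasite-complete ij))
    (some-tree-joins history initState valid (<-≤-trans v<N length-history))

  host-parasite-ranks-differ : ∀ {a b i j v} → rH o a b ≡ suc v → rP o i j ≢ suc v
  host-parasite-ranks-differ {a} {b} {i} {j} {v} ab ij = trees-join-at-distinct-times history initState v
    (rank≡suc⇒joinsAt hs initLabels a b host-complete (trans (sym (rH≡rank a b)) ab))
    (rank≡suc⇒joinsAt ps initLabels i j parasite-complete (trans (sym (rP≡rank i j)) ij))

module _ {n m : ℕ} {ℓ : Fin m → Fin n} where

  -- SameFacet o k o' k' unfolds to GluedAt o (toℕ k) o' (toℕ k').
  GluedAt : Orthant n m ℓ → ℕ → Orthant n m ℓ → ℕ → Set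
  GluedAt o A o' B = (∀ a b → collapseℕ (suc A) (rH o a b) ≡ collapseℕ (suc B) (rH o' a b))
                   × (∀ i j → collapseℕ (suc A) (rP o i j) ≡ collapseℕ (suc B) (rP o' i j))

  glued-sym : ∀ {o o' A B} → GluedAt o A o' B → GluedAt o' B o A
  glued-sym (gH , gP) = (λ a b → sym (gH a b)) , (λ i j → sym (gP i j))

  ¬glued-below : ∀ o o' {A B} → A < B → B < n + m ∸ 2 → ¬ GluedAt o A o' B
  ¬glued-below o o' {A} {suc B} A<B B<N (gH , gP) =
    vertices (vertexAt o' (<-trans (n<1+n B) B<N)) (vertexAt o' B<N)
    where
    module H = GluedRankings (host-ranking o) (host-ranking o') A<B gH
    module P = GluedRankings (parasite-ranking o) (parasite-ranking o') A<B gP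
    vertices : VertexAt o' B → VertexAt o' (suc B) → ⊥
    vertices (inj₁ (_ , _ , y)) (inj₁ (_ , _ , z)) = H.¬successive y z
    vertices (inj₂ (_ , _ , y)) (inj₂ (_ , _ , z)) = P.¬successive y z
    vertices (inj₁ (_ , _ , y)) (inj₂ (_ , _ , z)) = host-parasite-ranks-differ o (H.lift-B y) (P.lift-suc-B z)
    vertices (inj₂ (_ , _ , y)) (inj₁ (_ , _ , z)) = host-parasite-ranks-differ o (H.lift-suc-B z) (P.lift-B y)

  facet-index : ∀ o o' {k k'} → SameFacet o k o' k' → k ≡ k'
  facet-index o o' {k} {k'} g with <-cmp (toℕ k) (toℕ k')
  ... | tri< k<k' _ _ = ⊥-elim (¬glued-below o o' k<k' (toℕ<n k') g)
  ... | tri≈ _ k≡k' _ = toℕ-injective k≡k'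
  ... | tri> _ _ k>k' = ⊥-elim (¬glued-below o' o k>k' (toℕ<n k) (glued-sym {o} {o'} g))

  sameFacet-diagonal : ∀ o o' {k k'} → SameFacet o k o' k' → SameFacet o k o' k
  sameFacet-diagonal o o' {k} g = subst (SameFacet o k o') (sym (facet-index o o' g)) g

  glued-triangle : ∀ {o₁ o₂ o₃ : Orthant n m ℓ} {k j i}
                 → SameFacet o₁ k o₂ k → SameFacet o₂ j o₃ j → SameFacet o₃ i o₁ i
                 → j ≢ k → i ≢ k → SameOrthant o₁ o₂
  glued-triangle {o₁} {o₂} {o₃} {k} {j} {i} (gH₁₂ , gP₁₂) (gH₂₃ , gP₂₃) (gH₃₁ , gP₃₁) j≢k i≢k =
      (λ a b → collapse-triangle (rH o₁ a b) (rH o₂ a b) (rH o₃ a b)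
                                 (gH₁₂ a b) (gH₂₃ a b) (gH₃₁ a b) J≢K I≢K)
    , (λ x y → collapse-triangle (rP o₁ x y) (rP o₂ x y) (rP o₃ x y)
                                 (gP₁₂ x y) (gP₂₃ x y) (gP₃₁ x y) J≢K I≢K)
    where
    J≢K : toℕ j ≢ toℕ k
    J≢K = j≢k ∘ toℕ-injective
    I≢K : toℕ i ≢ toℕ k
    I≢K = i≢k ∘ toℕ-injective

mainTheorem3 : (n m : ℕ) → 1 ≤ n → 1 ≤ m → (ℓ : Fin m → Fin n)
    → (o₁ o₂ o₃ : Orthant n m ℓ)
    → ¬ SameOrthant o₁ o₂ → ¬ SameOrthant o₂ o₃ → ¬ SameOrthant o₃ o₁
    → (k₁₂ k₂₁ k₂₃ k₃₂ k₃₁ k₁₃ : Fin (n + m ∸ 2))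
    → SameFacet o₁ k₁₂ o₂ k₂₁
    → SameFacet o₂ k₂₃ o₃ k₃₂
    → SameFacet o₃ k₃₁ o₁ k₁₃
    → ¬ SameFacet o₁ k₁₂ o₂ k₂₃
    → ¬ SameFacet o₂ k₂₃ o₃ k₃₁
    → ¬ SameFacet o₃ k₃₁ o₁ k₁₂
    → ⊥
mainTheorem3 n m _ _ ℓ o₁ o₂ o₃ o₁≉o₂ _ _ k₁₂ k₂₁ k₂₃ k₃₂ k₃₁ k₁₃ g₁₂ g₂₃ g₃₁ ¬g₁₂₃ _ ¬g₃₁₂ =
  o₁≉o₂ (glued-triangle {o₁ = o₁} {o₂} {o₃} g₁₂′ g₂₃′ g₃₁′ k₂₃≢k₁₂ k₃₁≢k₁₂)
  where
  g₁₂′ : SameFacet o₁ k₁₂ o₂ k₁₂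
  g₁₂′ = sameFacet-diagonal o₁ o₂ g₁₂
  g₂₃′ : SameFacet o₂ k₂₃ o₃ k₂₃
  g₂₃′ = sameFacet-diagonal o₂ o₃ g₂₃
  g₃₁′ : SameFacet o₃ k₃₁ o₁ k₃₁
  g₃₁′ = sameFacet-diagonal o₃ o₁ g₃₁
  k₂₃≢k₁₂ : k₂₃ ≢ k₁₂
  k₂₃≢k₁₂ eq = ¬g₁₂₃ (subst (SameFacet o₁ k₁₂ o₂) (sym eq) g₁₂′)
  k₃₁≢k₁₂ : k₃₁ ≢ k₁₂
  k₃₁≢k₁₂ eq = ¬g₃₁₂ (subst (SameFacet o₃ k₃₁ o₁) eq g₃₁′)
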